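{- Let $(G,T)$ be a generated group with $T$ closed under $G$-conjugation, and let $\le$ be its prefix order. Then $g\le h$ if and only if there exists a $T$-reduced word $(t_1,t_2,\ldots,t_{\ell(h)})$ for $h$ containing as a (not necessarily contiguous) subword a word $(t_{i_1},\ldots,t_{i_{\ell(g)}})$, $1\le i_1<\cdots<i_{\ell(g)}\le\ell(h)$, that is a $T$-reduced word for $g$.
   Context: A generated group is a pair $(G,T)$ with $G$ a group and $T\subseteq G$ generating $G$ as a monoid. A $T$-word for $g$ is a sequence $(t_1,\ldots,t_\ell)$ of elements of $T$ with $g=t_1\cdots t_\ell$; $\ell(g)=\ell_T(g)$ is the minimum length of a $T$-word for $g$, and words achieving it are called $T$-reduced. The prefix order is $g\le h$ iff $\ell(g)+\ell(g^{ -1}h)=\ell(h)$. -}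

module Defs where

open import Level using (Level; _⊔_)
open import Algebra.Bundles using (Group)
open import Data.Nat using (ℕ; _+_)
open import Data.List using (List; []; _∷_; length; foldr)
open import Data.List.Relation.Unary.All using (All)
open import Data.List.Relation.Binary.Sublist.Propositional using (_⊆_)
open import Data.Product using (Σ; ∃; _×_; _,_)
open import Relation.Binary.PropositionalEquality using (_≡_)

module GeneratedGroup {c ℓ p : Level} (G : Group c ℓ) (T : Group.Carrier G → Set p) where
  open Group G

  prod : List Carrier → Carrier
  prod = foldr _∙_ ε

  IsTWord : List Carrier → Carrier → Set (c ⊔ ℓ ⊔ p)
  IsTWord w g = All T w × (prod w ≈ g)

  HasLength : Carrier → ℕ → Set (c ⊔ ℓ ⊔ p)
  HasLength g n = (Σ (List Carrier) λ w → IsTWord w g × length w ≡ n)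
                × (∀ w → IsTWord w g → n Data.Nat.≤ length w)

  IsReduced : List Carrier → Carrier → Set (c ⊔ ℓ ⊔ p)
  IsReduced w g = IsTWord w g × HasLength g (length w)

  _≤T_ : Carrier → Carrier → Set (c ⊔ ℓ ⊔ p)
  g ≤T h = Σ ℕ λ a → Σ ℕ λ b → Σ ℕ λ d →
           HasLength g a × HasLength (g ⁻¹ ∙ h) b × HasLength h d × (a + b ≡ d)

  Generates : Set (c ⊔ ℓ ⊔ p)
  Generates = ∀ g → Σ (List Carrier) λ w → IsTWord w g

  ConjClosed : Set (c ⊔ p)
  ConjClosed = ∀ g t → T t → T (g ∙ t ∙ g ⁻¹)

  Respects : Set (c ⊔ ℓ ⊔ p)
  Respects = ∀ {x y} → x ≈ y → T x → T y

-- Deleting a letter t of a T-word t₁ ⋯ tₙ at a position preceded by the product p of the kept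
-- letters does not lose t: since p ∙ (p⁻¹ t p) = t ∙ p, the deleted letter reappears to the right
-- of the kept ones as the conjugate p⁻¹ t p, which lies in T. Hence a subword v of a T-word w for h
-- has a complementary T-word for prod(v)⁻¹ h of length |w| - |v|. Applied to reduced words this
-- gives ℓ(g) + ℓ(g⁻¹h) ≤ ℓ(h), while concatenating reduced words always gives the reverse inequality.
module Submission where

open import Defs
open import Level using (Level; _⊔_)
open import Algebra.Bundles using (Group; Monoid)
open import Data.List using (List; []; _∷_; _++_; length; foldr)
open import Data.List.Properties using (length-++)
open import Data.List.Relation.Unary.All using (All; []; _∷_)
open import Data.List.Relation.Unary.All.Properties using (++⁺)
open import Data.List.Relation.Binary.Sublist.Propositional using (_⊆_; []; _∷_; _∷ʳ_; ⊆-refl)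
open import Data.List.Relation.Binary.Sublist.Propositional.Properties using (++⁺ʳ)
open import Data.Product using (Σ; _×_; _,_)
open import Data.Nat using (suc; _≤_; _+_)
open import Data.Nat.Properties using (+-cancelˡ-≤; +-suc)
open import Function.Bundles using (_⇔_; mk⇔)
open import Relation.Binary.PropositionalEquality as ≡ using (_≡_; refl)
import Algebra.Properties.Group as GroupProperties
import Relation.Binary.Reasoning.Setoid as SetoidReasoning

module _ {c ℓ : Level} (M : Monoid c ℓ) where
  open Monoid M
  open SetoidReasoning setoid

  foldr-∙-++ : (xs ys : List Carrier) →
               foldr _∙_ ε (xs ++ ys) ≈ foldr _∙_ ε xs ∙ foldr _∙_ ε ys
  foldr-∙-++ []       ys = sym (identityˡ _)
  foldr-∙-++ (x ∷ xs) ys = begin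
    x ∙ foldr _∙_ ε (xs ++ ys)               ≈⟨ ∙-congˡ (foldr-∙-++ xs ys) ⟩
    x ∙ (foldr _∙_ ε xs ∙ foldr _∙_ ε ys)    ≈⟨ assoc _ _ _ ⟨
    (x ∙ foldr _∙_ ε xs) ∙ foldr _∙_ ε ys    ∎

module _ {c ℓ p : Level} (G : Group c ℓ) (T : Group.Carrier G → Set p) where
  open Group G hiding (refl)
  open GeneratedGroup G T
  open GroupProperties G using (⁻¹-involutive; \\-cong₂; \\-leftDividesˡ; y≈x\\z)
  open SetoidReasoning setoid

  prod-++ : (u x : List Carrier) → prod (u ++ x) ≈ prod u ∙ prod x
  prod-++ = foldr-∙-++ monoid

  isTWord-resp : ∀ {w g g′} → g ≈ g′ → IsTWord w g → IsTWord w g′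
  isTWord-resp g≈g′ (tw , pw) = tw , trans pw g≈g′

  isTWord-++ : ∀ {u x g k} → IsTWord u g → IsTWord x k → IsTWord (u ++ x) (g ∙ k)
  isTWord-++ {u} {x} (tu , pu) (tx , px) = ++⁺ tu tx , trans (prod-++ u x) (∙-cong pu px)

  isTWord-++-\\ : ∀ {u x g h} → IsTWord u g → IsTWord x (g \\ h) → IsTWord (u ++ x) h
  isTWord-++-\\ {g = g} {h} tu tx = isTWord-resp (\\-leftDividesˡ g h) (isTWord-++ tu tx)

  hasLength⇒isReduced : ∀ {w g n} → HasLength g n → IsTWord w g → length w ≡ n → IsReduced w g
  hasLength⇒isReduced {g = g} ℓg tw |w|≡n = tw , ≡.subst (HasLength g) (≡.sym |w|≡n) ℓg

  isReduced-≤-++ : ∀ {w u x g h} → IsReduced w h → IsTWord u g → IsTWord x (g \\ h) →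
                   length w ≤ length u + length x
  isReduced-≤-++ {u = u} {x} (_ , _ , minimal) tu tx =
    ≡.subst (_ ≤_) (length-++ u) (minimal (u ++ x) (isTWord-++-\\ tu tx))

  ReducedSubword : Carrier → Carrier → Set (c ⊔ ℓ ⊔ p)
  ReducedSubword g h =
    Σ (List Carrier) λ w → IsReduced w h × (Σ (List Carrier) λ v → (v ⊆ w) × IsReduced v g)

  ≤T⇒reducedSubword : ∀ {g h} → g ≤T h → ReducedSubword g h
  ≤T⇒reducedSubword (a , b , d , ℓg@((u , tu , |u|≡a) , _) , ((x , tx , |x|≡b) , _) , ℓh , a+b≡d) =
    u ++ x , hasLength⇒isReduced ℓh (isTWord-++-\\ tu tx) |u++x|≡d
    , u , ++⁺ʳ x ⊆-refl , hasLength⇒isReduced ℓg tu |u|≡a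
    where
    |u++x|≡d : length (u ++ x) ≡ d
    |u++x|≡d = ≡.trans (length-++ u) (≡.trans (≡.cong₂ _+_ |u|≡a |x|≡b) a+b≡d)

  module _ (conj : ConjClosed) where

    ⊆-cofactor : ∀ {v w} → v ⊆ w → All T w →
                 Σ (List Carrier) λ w′ → All T w′ × (length v + length w′ ≡ length w)
                   × (prod w ≈ prod v ∙ prod w′)
    ⊆-cofactor [] [] = [] , [] , refl , sym (identityˡ _)
    ⊆-cofactor {v} {t ∷ ws} (t ∷ʳ v⊆w) (tt ∷ tw) with ⊆-cofactor v⊆w tw
    ... | w′ , tw′ , |v|+|w′|≡|w| , pw =
        t′ ∷ w′ , conj (pv ⁻¹) t tt ∷ tw′
        , ≡.trans (+-suc (length v) _) (≡.cong suc |v|+|w′|≡|w|) , moved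
      where
      pv t′ : Carrier
      pv = prod v
      t′ = pv ⁻¹ ∙ t ∙ pv ⁻¹ ⁻¹
      moved : t ∙ prod ws ≈ pv ∙ (t′ ∙ prod w′)
      moved = begin
        t ∙ prod ws                          ≈⟨ ∙-congˡ pw ⟩
        t ∙ (pv ∙ prod w′)                   ≈⟨ \\-leftDividesˡ pv _ ⟨
        pv ∙ (pv ⁻¹ ∙ (t ∙ (pv ∙ prod w′)))  ≈⟨ ∙-congˡ (∙-congˡ (assoc _ _ _)) ⟨
        pv ∙ (pv ⁻¹ ∙ (t ∙ pv ∙ prod w′))    ≈⟨ ∙-congˡ (assoc _ _ _) ⟨
        pv ∙ (pv ⁻¹ ∙ (t ∙ pv) ∙ prod w′)    ≈⟨ ∙-congˡ (∙-congʳ (assoc _ _ _)) ⟨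
        pv ∙ (pv ⁻¹ ∙ t ∙ pv ∙ prod w′)      ≈⟨ ∙-congˡ (∙-congʳ (∙-congˡ (⁻¹-involutive pv))) ⟨
        pv ∙ (t′ ∙ prod w′)                  ∎
    ⊆-cofactor (refl ∷ v⊆w) (_ ∷ tw) with ⊆-cofactor v⊆w tw
    ... | w′ , tw′ , |v|+|w′|≡|w| , pw =
        w′ , tw′ , ≡.cong suc |v|+|w′|≡|w| , trans (∙-congˡ pw) (sym (assoc _ _ _))

    reducedSubword⇒≤T : ∀ {g h} → ReducedSubword g h → g ≤T h
    reducedSubword⇒≤T {g} {h} (w , w-red@((tw , pw) , ℓh) , v , v⊆w , (tv , pv) , ℓg)
      with ⊆-cofactor v⊆w tw
    ... | w′ , tw′ , |v|+|w′|≡|w| , pw≈pv∙pw′ =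
      length v , length w′ , length w , ℓg , ℓ[g\\h] , ℓh , |v|+|w′|≡|w|
      where
      w′-word : IsTWord w′ (g \\ h)
      w′-word = tw′ , trans (y≈x\\z _ _ _ (sym pw≈pv∙pw′)) (\\-cong₂ pv pw)
      ℓ[g\\h] : HasLength (g \\ h) (length w′)
      ℓ[g\\h] = (w′ , w′-word , refl) , λ y ty →
        +-cancelˡ-≤ (length v) _ _
          (≡.subst (_≤ _) (≡.sym |v|+|w′|≡|w|) (isReduced-≤-++ w-red (tv , pv) ty))

proposition2p8 : {c ℓ p : Level} (G : Group c ℓ) (T : Group.Carrier G → Set p) →
    GeneratedGroup.Respects G T → GeneratedGroup.Generates G T → GeneratedGroup.ConjClosed G T →
    (g h : Group.Carrier G) →
    GeneratedGroup._≤T_ G T g h ⇔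
      (Σ (List (Group.Carrier G)) λ w → GeneratedGroup.IsReduced G T w h ×
        (Σ (List (Group.Carrier G)) λ v → (v ⊆ w) × GeneratedGroup.IsReduced G T v g))
proposition2p8 G T _ _ conj g h = mk⇔ (≤T⇒reducedSubword G T) (reducedSubword⇒≤T G T conj)
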